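{- Let $\lambda,\mu$ be strict partitions with $\mu\subseteq\lambda$, and let $\mathcal{C},\mathcal{C}'$ be configurations for $\lambda/\mu$ such that $\mathcal{C}'$ is obtained from $\mathcal{C}$ by exchanging the $0$'s of two rows $a$ and $b$, where in $\mathcal{C}$ row $a$ has type $(e,o)$ and row $b$ has type $(\emptyset,e)$, and in $\mathcal{C}'$ row $a$ has type $(\emptyset,o)$ and row $b$ has type $(e,\emptyset)$. Then $\kappa(\mathcal{C}')\le\kappa(\mathcal{C})$.
   Context: Let $S(\lambda)$ be the shifted diagram of $\lambda$ (row $i$ of the Young diagram shifted $i-1$ squares right). A configuration $\mathcal{C}$ of $0$'s for $\lambda/\mu$ assigns to each row $i$ an integer $z_i$ with $0\le z_i\le\lambda_i$ (the leftmost $z_i$ squares of row $i$ are filled with $0$, the other $\lambda_i-z_i$ squares are blank), such that the nonzero $z_i$'s, arranged in decreasing order, are exactly the parts of $\mu$. Exchanging the $0$'s of rows $a\ne b$ means replacing $(z_a,z_b)$ by $(z_b,z_a)$ (when this is again a configuration). Row types: $(e,e)$: $z_i>0$ even and $\lambda_i-z_i>0$ even; $(e,o)$: $z_i>0$ even, $\lambda_i-z_i$ odd; $(o,e)$: $z_i$ odd, $\lambda_i-z_i>0$ even; $(o,o)$: $z_i$ odd, $\lambda_i-z_i$ odd; $(\emptyset,e)$: $z_i=0$, $\lambda_i$ even; $(\emptyset,o)$: $z_i=0$, $\lambda_i$ odd; $(e,\emptyset)$: $z_i=\lambda_i$ even; $(o,\emptyset)$: $z_i=\lambda_i$ odd.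 Let $o_r$ (resp. $e_r$) be the number of rows with $z_i=0$ and $\lambda_i$ odd (resp. even), and $o_s$ (resp. $e_s$) the number of rows with $z_i>0$ and $\lambda_i-z_i$ odd (resp. even and nonzero). Define $\kappa(\mathcal{C})=o_s+2e_s+\max\big(o_r,\ e_r+((e_r+o_r)\bmod 2)\big)$. -}

module Defs where

open import Data.Nat using (ℕ; zero; suc; _+_; _*_; _∸_; _≤_; _<_; _⊔_; _≤?_; _%_)
open import Data.Nat.Properties using (_≟_)
open import Data.Bool using (Bool; true; false; _∧_; not; if_then_else_)
open import Data.List using (List; length; lookup; filter; tabulate)
open import Data.List.Relation.Unary.All using (All)
open import Data.List.Relation.Unary.Linked using (Linked)
open import Data.List.Relation.Binary.Permutation.Propositional using (_↭_)
open import Data.Fin using (Fin; toℕ)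
import Data.Fin as F
open import Data.Product using (_×_; Σ)
open import Relation.Nullary.Decidable using (does)
open import Relation.Binary.PropositionalEquality using (_≡_)

IsStrictPartition : List ℕ → Set
IsStrictPartition xs = Linked (λ a b → b < a) xs × All (λ a → 0 < a) xs

_⊆ₚ_ : List ℕ → List ℕ → Set
μ ⊆ₚ la = Σ (length μ ≤ length la)
  (λ _ → (i : Fin (length μ)) → (j : Fin (length la)) → toℕ i ≡ toℕ j → lookup μ i ≤ lookup la j)

Row : List ℕ → Set
Row la = Fin (length la)

isEven : ℕ → Bool
isEven n = does (n % 2 ≟ 0)

isOdd : ℕ → Bool
isOdd n = not (isEven n)

isPos : ℕ → Bool
isPos n = does (1 ≤? n)

-- A configuration of 0's for λ/μ: z i = number of 0's in row i.
-- The nonzero z i's, in decreasing order, are the parts of μ; since μ is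
-- a strict partition this is the same as: the list of nonzero z i's (in row
-- order) is a permutation of μ.
IsConfiguration : (la μ : List ℕ) → (Row la → ℕ) → Set
IsConfiguration la μ z =
  ((i : Row la) → z i ≤ lookup la i) × (filter (λ x → 1 ≤? x) (tabulate z) ↭ μ)

exchange : {n : ℕ} → (Fin n → ℕ) → Fin n → Fin n → Fin n → ℕ
exchange z a b i =
  if does (i F.≟ a) then z b else (if does (i F.≟ b) then z a else z i)

count : (n : ℕ) → (Fin n → Bool) → ℕ
count n p = length (filter (λ i → Data.Bool._≟_ (p i) true) (Data.List.allFin n))
  where import Data.Bool

o-r e-r o-s e-s : (la : List ℕ) → (Row la → ℕ) → ℕ
o-r la z = count (length la) (λ i → does (z i ≟ 0) ∧ isOdd (lookup la i))
e-r la z = count (length la) (λ i → does (z i ≟ 0) ∧ isEven (lookup la i))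
o-s la z = count (length la) (λ i → isPos (z i) ∧ isOdd (lookup la i ∸ z i))
e-s la z = count (length la) (λ i → isPos (z i) ∧ (isEven (lookup la i ∸ z i) ∧ isPos (lookup la i ∸ z i)))

κ : (la : List ℕ) → (Row la → ℕ) → ℕ
κ la z = o-s la z + 2 * e-s la z + (o-r la z ⊔ (e-r la z + (e-r la z + o-r la z) % 2))

Even Odd : ℕ → Set
Even n = n % 2 ≡ 0
Odd n = n % 2 ≡ 1

Type-eo : (la : List ℕ) → (Row la → ℕ) → Row la → Set
Type-eo la z i = (0 < z i) × Even (z i) × Odd (lookup la i ∸ z i)

Type-∅e : (la : List ℕ) → (Row la → ℕ) → Row la → Set
Type-∅e la z i = (z i ≡ 0) × Even (lookup la i)

Type-∅o : (la : List ℕ) → (Row la → ℕ) → Row la → Set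
Type-∅o la z i = (z i ≡ 0) × Odd (lookup la i)

-- type (e,∅): z=λ even  (rows of a strict partition are positive, so z>0)
Type-e∅ : (la : List ℕ) → (Row la → ℕ) → Row la → Set
Type-e∅ la z i = (z i ≡ lookup la i) × Even (lookup la i)

-- Exchanging the 0's of rows a and b leaves every other row unchanged, so only
-- the contributions of rows a and b to o_s, e_s, o_r, e_r change: row a moves
-- from type (e,o) to (∅,o) and row b from (∅,e) to (e,∅), which contributes to
-- none of the four statistics.  Hence (o_s, e_s, o_r, e_r) changes by
-- (−1, 0, +1, −1).  The parity term e_r + o_r keeps its parity, so the maximum
-- in κ grows by at most 1, and this is paid for by the loss of 1 in o_s.
module Submission where

open import Defs
open import Data.Nat using (ℕ; zero; suc; _+_; _*_; _∸_; _⊔_; _%_; _≤_; _<_; s≤s)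
open import Data.Nat.Properties
  using (_≟_; +-suc; n∸n≡0; n≤1+n; ≤-reflexive; ≤-trans; +-monoʳ-≤; ⊔-monoʳ-≤;
         +-0-commutativeMonoid; +-commutativeSemigroup)
open import Data.Bool using (Bool; true; false; _∧_; not; if_then_else_)
open import Data.Bool.Properties using (∧-zeroʳ)
import Data.Bool as Bool
open import Data.List using (List; length; lookup; filter; tabulate)
open import Data.Fin using (Fin; punchIn)
import Data.Fin as Fin
open import Data.Fin.Properties using (punchInᵢ≢i)
open import Data.Vec.Functional using (Vector; removeAt)
open import Algebra.Properties.CommutativeMonoid.Sum +-0-commutativeMonoid
  using (sum; sum-remove; sum-cong-≗)
open import Algebra.Properties.CommutativeSemigroup +-commutativeSemigroup using (x∙yz≈y∙xz)
open import Data.Product using (_,_)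
open import Data.Empty using (⊥-elim)
open import Function using (_∘_; id)
open import Relation.Nullary using (yes; no)
open import Relation.Nullary.Decidable using (does)
open import Relation.Binary.PropositionalEquality
open ≡-Reasoning

indicator : Bool → ℕ
indicator true  = 1
indicator false = 0

sum-update : ∀ {n} (g h : Vector ℕ n) (i : Fin n) → (∀ j → j ≢ i → g j ≡ h j) →
  h i + sum g ≡ g i + sum h
sum-update {suc n} g h i agree = begin
  h i + sum g                      ≡⟨ cong (h i +_) (sum-remove g) ⟩
  h i + (g i + sum (removeAt g i)) ≡⟨ x∙yz≈y∙xz (h i) (g i) _ ⟩
  g i + (h i + sum (removeAt g i)) ≡⟨ cong (λ s → g i + (h i + s)) (sum-cong-≗ agree₋) ⟩
  g i + (h i + sum (removeAt h i)) ≡⟨ cong (g i +_) (sum-remove h) ⟨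
  g i + sum h                      ∎
  where
  agree₋ : ∀ j → removeAt g i j ≡ removeAt h i j
  agree₋ j = agree (punchIn i j) (punchInᵢ≢i i j)

sum-update₂ : ∀ {n} (g h : Vector ℕ n) (a b : Fin n) → a ≢ b →
  (∀ j → j ≢ a → j ≢ b → g j ≡ h j) →
  h a + (h b + sum g) ≡ g a + (g b + sum h)
sum-update₂ g h a b a≢b agree = begin
  h a + (h b + sum g) ≡⟨ x∙yz≈y∙xz (h a) (h b) _ ⟩
  h b + (h a + sum g) ≡⟨ cong (h b +_) step-a ⟩
  h b + (g a + sum r) ≡⟨ x∙yz≈y∙xz (h b) (g a) _ ⟩
  g a + (h b + sum r) ≡⟨ cong (g a +_) step-b ⟩
  g a + (g b + sum h) ∎
  where
  r : Vector ℕ _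
  r j = if does (j Fin.≟ b) then g j else h j
  r-a : r a ≡ h a
  r-a with a Fin.≟ b
  ... | yes a≡b = ⊥-elim (a≢b a≡b)
  ... | no _    = refl
  r-b : r b ≡ g b
  r-b with b Fin.≟ b
  ... | yes _   = refl
  ... | no b≢b  = ⊥-elim (b≢b refl)
  g≗r : ∀ j → j ≢ a → g j ≡ r j
  g≗r j j≢a with j Fin.≟ b
  ... | yes _   = refl
  ... | no j≢b  = agree j j≢a j≢b
  r≗h : ∀ j → j ≢ b → r j ≡ h j
  r≗h j j≢b with j Fin.≟ b
  ... | yes j≡b = ⊥-elim (j≢b j≡b)
  ... | no _    = refl
  step-a : h a + sum g ≡ g a + sum r
  step-a = subst (λ x → x + sum g ≡ g a + sum r) r-a (sum-update g r a g≗r)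
  step-b : h b + sum r ≡ g b + sum h
  step-b = subst (λ x → h b + sum r ≡ x + sum h) r-b (sum-update r h b r≗h)

length-filter-tabulate : ∀ {A : Set} {n} (p : A → Bool) (f : Fin n → A) →
  length (filter (λ x → Bool._≟_ (p x) true) (tabulate f)) ≡ sum (indicator ∘ p ∘ f)
length-filter-tabulate {n = zero}  p f = refl
length-filter-tabulate {n = suc n} p f with p (f Fin.zero)
... | true  = cong suc (length-filter-tabulate p (f ∘ Fin.suc))
... | false = length-filter-tabulate p (f ∘ Fin.suc)

count≡sum : ∀ n (p : Fin n → Bool) → count n p ≡ sum (indicator ∘ p)
count≡sum n p = length-filter-tabulate p id

count-update₂ : ∀ n (p q : Fin n → Bool) (a b : Fin n) → a ≢ b →
  (∀ i → i ≢ a → i ≢ b → p i ≡ q i) →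
  indicator (q a) + (indicator (q b) + count n p) ≡
  indicator (p a) + (indicator (p b) + count n q)
count-update₂ n p q a b a≢b agree
  rewrite count≡sum n p | count≡sum n q =
  sum-update₂ (indicator ∘ p) (indicator ∘ q) a b a≢b
    (λ i i≢a i≢b → cong indicator (agree i i≢a i≢b))

exchange-elsewhere : ∀ {n} (z : Fin n → ℕ) {a b i} → i ≢ a → i ≢ b → exchange z a b i ≡ z i
exchange-elsewhere z {a} {b} {i} i≢a i≢b with i Fin.≟ a
... | yes i≡a = ⊥-elim (i≢a i≡a)
... | no _ with i Fin.≟ b
...   | yes i≡b = ⊥-elim (i≢b i≡b)
...   | no _    = refl

exchange-at-second : ∀ {n} (z : Fin n → ℕ) {a b} → a ≢ b → exchange z a b b ≡ z a
exchange-at-second z {a} {b} a≢b with b Fin.≟ a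
... | yes b≡a = ⊥-elim (a≢b (sym b≡a))
... | no _ with b Fin.≟ b
...   | yes _   = refl
...   | no b≢b  = ⊥-elim (b≢b refl)

oddTail evenTail emptyOdd emptyEven : ℕ → ℕ → Bool
oddTail   l x = isPos x ∧ isOdd (l ∸ x)
evenTail  l x = isPos x ∧ (isEven (l ∸ x) ∧ isPos (l ∸ x))
emptyOdd  l x = does (x ≟ 0) ∧ isOdd l
emptyEven l x = does (x ≟ 0) ∧ isEven l

rowCount : (la : List ℕ) → (ℕ → ℕ → Bool) → (Row la → ℕ) → ℕ
rowCount la g z = count (length la) (λ i → g (lookup la i) (z i))

isEven-even : ∀ n → Even n → isEven n ≡ true
isEven-even _ n%2≡0 = cong (λ r → does (r ≟ 0)) n%2≡0

isEven-odd : ∀ n → Odd n → isEven n ≡ false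
isEven-odd _ n%2≡1 = cong (λ r → does (r ≟ 0)) n%2≡1

isPos-pos : ∀ {n} → 0 < n → isPos n ≡ true
isPos-pos (s≤s _) = refl

≟0-pos : ∀ {n} → 0 < n → does (n ≟ 0) ≡ false
≟0-pos (s≤s _) = refl

oddTail-odd : ∀ l x → 0 < x → Odd (l ∸ x) → oddTail l x ≡ true
oddTail-odd l x x>0 odd = cong₂ _∧_ (isPos-pos x>0) (cong not (isEven-odd (l ∸ x) odd))

evenTail-odd : ∀ l x → Odd (l ∸ x) → evenTail l x ≡ false
evenTail-odd l x odd =
  trans (cong (λ e → isPos x ∧ (e ∧ isPos (l ∸ x))) (isEven-odd (l ∸ x) odd)) (∧-zeroʳ (isPos x))

oddTail-full : ∀ l → oddTail l l ≡ false
oddTail-full l = trans (cong (λ d → isPos l ∧ isOdd d) (n∸n≡0 l)) (∧-zeroʳ (isPos l))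

evenTail-full : ∀ l → evenTail l l ≡ false
evenTail-full l =
  trans (cong (λ d → isPos l ∧ (isEven d ∧ isPos d)) (n∸n≡0 l)) (∧-zeroʳ (isPos l))

emptyOdd-pos : ∀ l {x} → 0 < x → emptyOdd l x ≡ false
emptyOdd-pos l x>0 = cong (_∧ isOdd l) (≟0-pos x>0)

emptyEven-pos : ∀ l {x} → 0 < x → emptyEven l x ≡ false
emptyEven-pos l x>0 = cong (_∧ isEven l) (≟0-pos x>0)

kappa : ℕ → ℕ → ℕ → ℕ → ℕ
kappa os es or er = os + 2 * es + (or ⊔ (er + (er + or) % 2))

kappa-exchange : ∀ {os es or er os′ es′ or′ er′} →
  os ≡ suc os′ → es ≡ es′ → suc or ≡ or′ → er ≡ suc er′ →
  kappa os′ es′ or′ er′ ≤ kappa os es or er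
kappa-exchange {or = or} {os′ = os′} {es′} {er′ = er′} refl refl refl refl =
  ≤-trans (+-monoʳ-≤ (os′ + 2 * es′) max-grows) (≤-reflexive (+-suc (os′ + 2 * es′) _))
  where
  max-grows : suc or ⊔ (er′ + (er′ + suc or) % 2) ≤ suc (or ⊔ (suc er′ + (suc er′ + or) % 2))
  max-grows rewrite +-suc er′ or =
    ≤-trans (⊔-monoʳ-≤ (suc or) (n≤1+n _)) (s≤s (⊔-monoʳ-≤ or (n≤1+n _)))

module Exchange (la : List ℕ) (z z′ : Row la → ℕ) (a b : Row la) (a≢b : a ≢ b)
         (z′≡exchange : (i : Row la) → z′ i ≡ exchange z a b i)
         (za>0 : 0 < z a) (a-tail-odd : Odd (lookup la a ∸ z a))
         (zb≡0 : z b ≡ 0) (Lb-even : Even (lookup la b))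
         (z′a≡0 : z′ a ≡ 0) (La-odd : Odd (lookup la a))
         (z′b≡Lb : z′ b ≡ lookup la b) where

  private
    La Lb : ℕ
    La = lookup la a
    Lb = lookup la b

  -- The contributions of rows a and b come first so that, once they are known
  -- Booleans, the equation reduces definitionally to one like S ≡ suc S′.
  rowCount-exchange : ∀ (g : ℕ → ℕ → Bool) {u v u′ v′} →
    g La (z a) ≡ u → g Lb (z b) ≡ v → g La (z′ a) ≡ u′ → g Lb (z′ b) ≡ v′ →
    indicator u′ + (indicator v′ + rowCount la g z) ≡
    indicator u + (indicator v + rowCount la g z′)
  rowCount-exchange g refl refl refl refl =
    count-update₂ (length la) _ _ a b a≢b
      (λ i i≢a i≢b → cong (g (lookup la i))
        (sym (trans (z′≡exchange i) (exchange-elsewhere z i≢a i≢b))))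

  z′b>0 : 0 < z′ b
  z′b>0 = subst (0 <_) (sym (trans (z′≡exchange b) (exchange-at-second z a≢b))) za>0

  o-s-drops : o-s la z ≡ suc (o-s la z′)
  o-s-drops = rowCount-exchange oddTail
    (oddTail-odd La (z a) za>0 a-tail-odd) (cong (oddTail Lb) zb≡0)
    (cong (oddTail La) z′a≡0) (trans (cong (oddTail Lb) z′b≡Lb) (oddTail-full Lb))

  e-s-unchanged : e-s la z ≡ e-s la z′
  e-s-unchanged = rowCount-exchange evenTail
    (evenTail-odd La (z a) a-tail-odd) (cong (evenTail Lb) zb≡0)
    (cong (evenTail La) z′a≡0) (trans (cong (evenTail Lb) z′b≡Lb) (evenTail-full Lb))

  o-r-grows : suc (o-r la z) ≡ o-r la z′
  o-r-grows = rowCount-exchange emptyOdd (emptyOdd-pos La za>0)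
    (trans (cong (emptyOdd Lb) zb≡0) (cong not (isEven-even Lb Lb-even)))
    (trans (cong (emptyOdd La) z′a≡0) (cong not (isEven-odd La La-odd)))
    (emptyOdd-pos Lb z′b>0)

  e-r-drops : e-r la z ≡ suc (e-r la z′)
  e-r-drops = rowCount-exchange emptyEven (emptyEven-pos La za>0)
    (trans (cong (emptyEven Lb) zb≡0) (isEven-even Lb Lb-even))
    (trans (cong (emptyEven La) z′a≡0) (isEven-odd La La-odd))
    (emptyEven-pos Lb z′b>0)

mainTheorem9 : (la μ : List ℕ) → IsStrictPartition la → IsStrictPartition μ → μ ⊆ₚ la →
    (z z′ : Row la → ℕ) → IsConfiguration la μ z → IsConfiguration la μ z′ →
    (a b : Row la) → a ≢ b → ((i : Row la) → z′ i ≡ exchange z a b i) →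
    Type-eo la z a → Type-∅e la z b → Type-∅o la z′ a → Type-e∅ la z′ b →
    κ la z′ ≤ κ la z
mainTheorem9 la _ _ _ _ z z′ _ _ a b a≢b z′≡exchange
  (za>0 , _ , a-tail-odd) (zb≡0 , Lb-even) (z′a≡0 , La-odd) (z′b≡Lb , _) =
  kappa-exchange o-s-drops e-s-unchanged o-r-grows e-r-drops
  where
  open Exchange la z z′ a b a≢b z′≡exchange za>0 a-tail-odd zb≡0 Lb-even z′a≡0 La-odd z′b≡Lb
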